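{- Let $x,y\in\{0,1\}^n$ with $d(x,y)=w$, and for $0\le t\le n$ let $\mu_t(x,y)=|B(x,t)\cap B(y,t)|$. Then $$\mu_t(x,y)=2^{ -n}\sum_{k=0}^n c_k(t)^2K_k^{(n)}(w),$$ where $c_0(t)=\sum_{i=0}^t\binom ni$ and, for $k=1,\dots,n$, $c_k(t)=K_t^{(n-1)}(k-1)$ if $0\le t\le n-1$ and $c_k(n)=0$.
   Context: $d$ is the Hamming distance and $B(x,t)=\{y:d(x,y)\le t\}$. The Krawtchouk polynomials are $K_k^{(n)}(x)=\sum_{i=0}^k(-1)^i\binom xi\binom{n-x}{k-i}$, $k=0,\dots,n$ (so $K_k^{(n)}(0)=\binom nk$); they satisfy $\sum_{l=0}^n\binom nl K_i^{(n)}(l)K_j^{(n)}(l)=2^n\binom ni\delta_{ij}$. -}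

module Defs where

open import Data.Nat using (ℕ; zero; suc; _≤ᵇ_; _∸_)
open import Data.Nat.Combinatorics using (_C_)
open import Data.Bool using (Bool; true; false; _∧_; if_then_else_)
open import Data.Vec using (Vec; []; _∷_)
open import Data.List using (List; []; _∷_; map; _++_; filter; length; sum; upTo)
open import Data.Integer as ℤ using (ℤ; +_; -_)
open import Relation.Nullary.Decidable using (does)

hamming : ∀ {n} → Vec Bool n → Vec Bool n → ℕ
hamming [] [] = 0
hamming (a ∷ xs) (b ∷ ys) = (if (a Data.Bool.xor b) then 1 else 0) Data.Nat.+ hamming xs ys

allVecs : (n : ℕ) → List (Vec Bool n)
allVecs zero = [] ∷ []
allVecs (suc n) = map (false ∷_) (allVecs n) ++ map (true ∷_) (allVecs n)

inBoth : ∀ {n} → ℕ → Vec Bool n → Vec Bool n → Vec Bool n → Bool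
inBoth t x y z = (hamming x z ≤ᵇ t) ∧ (hamming y z ≤ᵇ t)

μ : ∀ {n} → ℕ → Vec Bool n → Vec Bool n → ℕ
μ {n} t x y = length (filter (λ z → Data.Bool._≟_ (inBoth t x y z) true) (allVecs n))

sumℤ : ℕ → (ℕ → ℤ) → ℤ
sumℤ zero f = f 0
sumℤ (suc m) f = sumℤ m f ℤ.+ f (suc m)

sumℕ : ℕ → (ℕ → ℕ) → ℕ
sumℕ zero f = f 0
sumℕ (suc m) f = sumℕ m f Data.Nat.+ f (suc m)

sgn : ℕ → ℤ
sgn zero = + 1
sgn (suc i) = - sgn i

-- Krawtchouk polynomial K_k^{(n)}(x) = Σ_{i=0}^k (-1)^i C(x,i) C(n-x,k-i)
-- (evaluated at integers 0 ≤ x ≤ n; ∸ is only used with x ≤ n in the statement)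
K : (n k x : ℕ) → ℤ
K n k x = sumℤ k (λ i → sgn i ℤ.* (+ (x C i)) ℤ.* (+ ((n ∸ x) C (k ∸ i))))

c : (n t k : ℕ) → ℤ
c n t zero = + sumℕ t (λ i → n C i)
c n t (suc k') = if does (Data.Nat._≟_ t n) then + 0 else K (n ∸ 1) t k'

module Submission where

-- We use the characters χ_u(z) = (-1)^{u·z} of {0,1}^n and the (unnormalised)
-- Walsh–Hadamard transform  f̂(u) = Σ_z χ_u(z) f(z).  Three general facts,
-- each proved by induction on the dimension n (splitting off the first bit):
--  (1) Parseval:  2^n Σ_z f(z) g(z) = Σ_u f̂(u) ĝ(u).
--  (2) The transform of the indicator of the ball {z : d(x,z) < r} is
--      χ_u(x) ψ_n(r, |u|), for an explicit "ball spectrum" ψ depending only on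
--      the weight |u|; the induction step is a Pascal-type recurrence for ψ.
--  (3) For every h : ℕ → ℤ,  Σ_u χ_u(x) χ_u(y) h(|u|) = Σ_k h(k) K_k(d(x,y)).
-- Both recurrences come from the Pascal rules of the Krawtchouk polynomials,
-- which we derive for the general sums Σ_i (-1)^i C(a,i) C(b,k-i).
-- Writing μ_t(x,y) = Σ_z 1[d(x,z) ≤ t] 1[d(y,z) ≤ t] and chaining (1)-(3) gives
-- 2^n μ_t = Σ_k ψ_n(t+1,k)^2 K_k(w); finally ψ_n(t+1,k) = c_k(t).  (The argument
-- does not use the hypothesis t ≤ n: the formula holds for every t.)

open import Defs
open import Data.Nat as ℕ using (ℕ; zero; suc; _≤_; _<_; _^_; _∸_; z≤n; s≤s; _≤ᵇ_; _<ᵇ_)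
open import Data.Nat.Properties as ℕP using ()
open import Data.Nat.Combinatorics using (_C_; nCk+nC[k+1]≡[n+1]C[k+1]; k>n⇒nCk≡0)
open import Data.Nat.Tactic.RingSolver using () renaming (solve-∀ to ℕ-solve)
open import Data.Bool using (Bool; true; false; _∧_; _xor_; if_then_else_)
open import Data.Bool.Properties using (∧-zeroʳ; ∧-identityʳ)
open import Data.Vec using (Vec; []; _∷_)
open import Data.List using (List; []; _∷_; map; _++_; filter; length)
open import Data.Integer as ℤ using (ℤ; +_; -_; _+_; _*_; _-_; -1ℤ)
open import Data.Integer.Properties as ℤP using ()
open import Data.Integer.Tactic.RingSolver using (solve-∀)
open import Relation.Nullary using (yes; no; does; Dec)
open import Relation.Binary.PropositionalEquality
open ≡-Reasoning

sumℤ-cong : ∀ m {f g : ℕ → ℤ} → (∀ i → i ≤ m → f i ≡ g i) → sumℤ m f ≡ sumℤ m g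
sumℤ-cong zero    eq = eq 0 z≤n
sumℤ-cong (suc m) eq =
  cong₂ _+_ (sumℤ-cong m (λ i i≤m → eq i (ℕP.m≤n⇒m≤1+n i≤m))) (eq (suc m) ℕP.≤-refl)

sumℤ-+ : ∀ m (f g : ℕ → ℤ) → sumℤ m (λ i → f i + g i) ≡ sumℤ m f + sumℤ m g
sumℤ-+ zero    f g = refl
sumℤ-+ (suc m) f g =
  trans (cong (_+ (f (suc m) + g (suc m))) (sumℤ-+ m f g))
        (interchange (sumℤ m f) (sumℤ m g) (f (suc m)) (g (suc m)))
  where
  interchange : ∀ a b p q → a + b + (p + q) ≡ a + p + (b + q)
  interchange = solve-∀

sumℤ-* : ∀ m (s : ℤ) (f : ℕ → ℤ) → sumℤ m (λ i → s * f i) ≡ s * sumℤ m f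
sumℤ-* zero    s f = refl
sumℤ-* (suc m) s f =
  trans (cong (_+ s * f (suc m)) (sumℤ-* m s f)) (sym (ℤP.*-distribˡ-+ s _ _))

sumℤ-neg : ∀ m (f : ℕ → ℤ) → sumℤ m (λ i → - f i) ≡ - sumℤ m f
sumℤ-neg zero    f = refl
sumℤ-neg (suc m) f =
  trans (cong (_+ - f (suc m)) (sumℤ-neg m f)) (sym (ℤP.neg-distrib-+ (sumℤ m f) _))

sumℤ-shift : ∀ m (f : ℕ → ℤ) → sumℤ (suc m) f ≡ f 0 + sumℤ m (λ i → f (suc i))
sumℤ-shift zero    f = refl
sumℤ-shift (suc m) f =
  trans (cong (_+ f (suc (suc m))) (sumℤ-shift m f)) (ℤP.+-assoc (f 0) _ _)

sumℤ-vanish : ∀ m (f : ℕ → ℤ) → (∀ i → i ≤ m → f i ≡ + 0) → sumℤ m f ≡ + 0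
sumℤ-vanish m f zeros = trans (sumℤ-cong m zeros) (constant-zero m)
  where
  constant-zero : ∀ m → sumℤ m (λ _ → + 0) ≡ + 0
  constant-zero zero    = refl
  constant-zero (suc m) = cong (_+ + 0) (constant-zero m)

sumℤ-head : ∀ m (f : ℕ → ℤ) → (∀ i → f (suc i) ≡ + 0) → sumℤ m f ≡ f 0
sumℤ-head zero    f zeros = refl
sumℤ-head (suc m) f zeros =
  trans (cong₂ _+_ (sumℤ-head m f zeros) (zeros m)) (ℤP.+-identityʳ (f 0))

ΣL : ∀ {A : Set} → List A → (A → ℤ) → ℤ
ΣL []      f = + 0
ΣL (a ∷ l) f = f a + ΣL l f

module _ {A : Set} where

  ΣL-cong : ∀ (l : List A) {f g : A → ℤ} → (∀ a → f a ≡ g a) → ΣL l f ≡ ΣL l g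
  ΣL-cong []      eq = refl
  ΣL-cong (a ∷ l) eq = cong₂ _+_ (eq a) (ΣL-cong l eq)

  ΣL-++ : ∀ (l₁ l₂ : List A) f → ΣL (l₁ ++ l₂) f ≡ ΣL l₁ f + ΣL l₂ f
  ΣL-++ []       l₂ f = sym (ℤP.+-identityˡ _)
  ΣL-++ (a ∷ l₁) l₂ f =
    trans (cong (_+_ (f a)) (ΣL-++ l₁ l₂ f)) (sym (ℤP.+-assoc (f a) _ _))

  ΣL-+ : ∀ (l : List A) f g → ΣL l (λ a → f a + g a) ≡ ΣL l f + ΣL l g
  ΣL-+ []      f g = refl
  ΣL-+ (a ∷ l) f g =
    trans (cong (_+_ (f a + g a)) (ΣL-+ l f g)) (interchange (f a) (g a) _ _)
    where
    interchange : ∀ a b p q → a + b + (p + q) ≡ a + p + (b + q)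
    interchange = solve-∀

  ΣL-* : ∀ (l : List A) s f → ΣL l (λ a → s * f a) ≡ s * ΣL l f
  ΣL-* []      s f = sym (ℤP.*-zeroʳ s)
  ΣL-* (a ∷ l) s f =
    trans (cong (_+_ (s * f a)) (ΣL-* l s f)) (sym (ℤP.*-distribˡ-+ s (f a) _))

ΣL-map : ∀ {A B : Set} (g : A → B) (l : List A) f → ΣL (map g l) f ≡ ΣL l (λ a → f (g a))
ΣL-map g []      f = refl
ΣL-map g (a ∷ l) f = cong (_+_ (f (g a))) (ΣL-map g l f)

ΣV : (n : ℕ) → (Vec Bool n → ℤ) → ℤ
ΣV n = ΣL (allVecs n)

ΣV-suc : ∀ n f → ΣV (suc n) f ≡ ΣV n (λ z → f (false ∷ z)) + ΣV n (λ z → f (true ∷ z))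
ΣV-suc n f = trans (ΣL-++ (map (false ∷_) (allVecs n)) _ f)
  (cong₂ _+_ (ΣL-map (false ∷_) (allVecs n) f) (ΣL-map (true ∷_) (allVecs n) f))

-- The summand (-1)^i C(a,i) C(b,j); the general sum
--   Kg a b k = Σ_{i ≤ k} (-1)^i C(a,i) C(b,k-i)
-- is the coefficient of z^k in (1-z)^a (1+z)^b, and K n k x = Kg x (n-x) k.
coeff : ℕ → ℕ → ℕ → ℕ → ℤ
coeff a b i j = sgn i * + (a C i) * + (b C j)

Kg : ℕ → ℕ → ℕ → ℤ
Kg a b k = sumℤ k (λ i → coeff a b i (k ∸ i))

pascalℤ : ∀ m j → + (suc m C suc j) ≡ + (m C j) + + (m C suc j)
pascalℤ m j = trans (cong +_ (sym (nCk+nC[k+1]≡[n+1]C[k+1] m j))) (sym (ℤP.pos-+ (m C j) _))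

-- Multiplying by (1+z):  Kg a (b+1) (k+1) = Kg a b (k+1) + Kg a b k.
Kg-pascalᵇ : ∀ a b k → Kg a (suc b) (suc k) ≡ Kg a b (suc k) + Kg a b k
Kg-pascalᵇ a b k = begin
    sumℤ k (λ i → coeff a (suc b) i (suc k ∸ i)) + top (suc b)
  ≡⟨ cong₂ _+_ (sumℤ-cong k split) (top-zero b) ⟩
    sumℤ k (λ i → coeff a b i (suc k ∸ i) + coeff a b i (k ∸ i)) + top b
  ≡⟨ cong (_+ top b) (sumℤ-+ k _ _) ⟩
    sumℤ k (λ i → coeff a b i (suc k ∸ i)) + Kg a b k + top b
  ≡⟨ swap (sumℤ k (λ i → coeff a b i (suc k ∸ i))) (Kg a b k) (top b) ⟩
    Kg a b (suc k) + Kg a b k ∎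
  where
  -- the top term i = k+1 only involves C(b,0) = 1
  top : ℕ → ℤ
  top b′ = coeff a b′ (suc k) (k ∸ k)
  top-zero : ∀ b′ → top (suc b′) ≡ top b′
  top-zero b′ rewrite ℕP.n∸n≡0 k = refl
  split : ∀ i → i ≤ k →
    coeff a (suc b) i (suc k ∸ i) ≡ coeff a b i (suc k ∸ i) + coeff a b i (k ∸ i)
  split i i≤k rewrite ℕP.+-∸-assoc 1 i≤k =
    trans (cong (sgn i * + (a C i) *_)
                (trans (pascalℤ b (k ∸ i)) (ℤP.+-comm (+ (b C (k ∸ i))) (+ (b C suc (k ∸ i))))))
          (ℤP.*-distribˡ-+ (sgn i * + (a C i)) (+ (b C suc (k ∸ i))) (+ (b C (k ∸ i))))
  swap : ∀ p q r → p + q + r ≡ p + r + q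
  swap = solve-∀

-- Multiplying by (1-z):  Kg (a+1) b (k+1) = Kg a b (k+1) - Kg a b k.
Kg-pascalᵃ : ∀ a b k → Kg (suc a) b (suc k) ≡ Kg a b (suc k) - Kg a b k
Kg-pascalᵃ a b k = begin
    Kg (suc a) b (suc k)
  ≡⟨ sumℤ-shift k _ ⟩
    coeff a b 0 (suc k) + sumℤ k (λ i → coeff (suc a) b (suc i) (k ∸ i))
  ≡⟨ cong (_+_ (coeff a b 0 (suc k))) (sumℤ-cong k (λ i _ → split i (k ∸ i))) ⟩
    coeff a b 0 (suc k) + sumℤ k (λ i → - coeff a b i (k ∸ i) + coeff a b (suc i) (k ∸ i))
  ≡⟨ cong (_+_ (coeff a b 0 (suc k))) (trans (sumℤ-+ k _ _) (cong (_+ rest) (sumℤ-neg k _))) ⟩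
    coeff a b 0 (suc k) + (- Kg a b k + rest)
  ≡⟨ regroup (coeff a b 0 (suc k)) (Kg a b k) rest ⟩
    (coeff a b 0 (suc k) + rest) - Kg a b k
  ≡⟨ cong (_- Kg a b k) (sym (sumℤ-shift k _)) ⟩
    Kg a b (suc k) - Kg a b k ∎
  where
  rest : ℤ
  rest = sumℤ k (λ i → coeff a b (suc i) (k ∸ i))
  split : ∀ i j → coeff (suc a) b (suc i) j ≡ - coeff a b i j + coeff a b (suc i) j
  split i j = trans (cong (λ v → - sgn i * v * + (b C j)) (pascalℤ a i))
                    (distrib (sgn i) (+ (a C i)) (+ (a C suc i)) (+ (b C j)))
    where
    distrib : ∀ s p q r → - s * (p + q) * r ≡ - (s * p * r) + - s * q * r
    distrib = solve-∀
  regroup : ∀ p q r → p + (- q + r) ≡ (p + r) - q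
  regroup = solve-∀

Kg-zeroᵃ : ∀ b k → Kg 0 b k ≡ + (b C k)
Kg-zeroᵃ b k = trans (sumℤ-head k _ vanish) (ℤP.*-identityˡ (+ (b C k)))
  where
  vanish : ∀ i → coeff 0 b (suc i) (k ∸ suc i) ≡ + 0
  vanish i = cong (_* + (b C (k ∸ suc i))) (ℤP.*-zeroʳ (sgn (suc i)))

K-pascal-n : ∀ n k x → x ≤ n → K (suc n) (suc k) x ≡ K n (suc k) x + K n k x
K-pascal-n n k x x≤n rewrite ℕP.+-∸-assoc 1 x≤n = Kg-pascalᵇ x (n ∸ x) k

K-pascal-x : ∀ n k x → K (suc n) (suc k) (suc x) ≡ K n (suc k) x - K n k x
K-pascal-x n k x = Kg-pascalᵃ x (n ∸ x) k

-- K_k^{(n)}(x) = 0 for k > n: each term has i > x or k - i > n - x.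
K-vanish : ∀ n k x → x ≤ n → n < k → K n k x ≡ + 0
K-vanish n k x x≤n n<k = sumℤ-vanish k _ term-zero
  where
  term-zero : ∀ i → i ≤ k → coeff x (n ∸ x) i (k ∸ i) ≡ + 0
  term-zero i i≤k with x ℕ.<? i
  ... | yes x<i = trans (cong (λ v → sgn i * + v * + ((n ∸ x) C (k ∸ i))) (k>n⇒nCk≡0 x<i))
                        (cong (_* + ((n ∸ x) C (k ∸ i))) (ℤP.*-zeroʳ (sgn i)))
  ... | no x≮i = trans (cong (λ v → sgn i * + (x C i) * + v) (k>n⇒nCk≡0 n-x<k-i))
                       (ℤP.*-zeroʳ (sgn i * + (x C i)))
    where
    n-x<k-i : n ∸ x < k ∸ i
    n-x<k-i = ℕP.<-≤-trans (ℕP.∸-monoˡ-< n<k x≤n) (ℕP.∸-monoʳ-≤ k (ℕP.≮⇒≥ x≮i))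

-- It is used with a = b = K^{(n)}(w) and d = K^{(n+1)}(w′).
sum-recombine : ∀ n (h a b d : ℕ → ℤ) (s : ℤ) → a (suc n) ≡ + 0 → d 0 ≡ a 0 →
  (∀ k → d (suc k) ≡ a (suc k) + s * b k) →
  sumℤ n (λ k → h k * a k) + s * sumℤ n (λ k → h (suc k) * b k)
    ≡ sumℤ (suc n) (λ k → h k * d k)
sum-recombine n h a b d s top base step = begin
    sumℤ n (λ k → h k * a k) + s * B
  ≡⟨ cong (_+ s * B) (sym drop-top) ⟩
    sumℤ (suc n) (λ k → h k * a k) + s * B
  ≡⟨ cong (_+ s * B) (sumℤ-shift n _) ⟩
    h 0 * a 0 + A′ + s * B
  ≡⟨ ℤP.+-assoc (h 0 * a 0) A′ (s * B) ⟩
    h 0 * a 0 + (A′ + s * B)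
  ≡⟨ cong₂ (λ p q → h 0 * p + q) (sym base)
           (sym (trans (sumℤ-+ n _ _) (cong (_+_ A′) (sumℤ-* n s _)))) ⟩
    h 0 * d 0 + sumℤ n (λ k → h (suc k) * a (suc k) + s * (h (suc k) * b k))
  ≡⟨ cong (_+_ (h 0 * d 0)) (sumℤ-cong n (λ k _ → sym (expand k))) ⟩
    h 0 * d 0 + sumℤ n (λ k → h (suc k) * d (suc k))
  ≡⟨ sym (sumℤ-shift n _) ⟩
    sumℤ (suc n) (λ k → h k * d k) ∎
  where
  A′ B : ℤ
  A′ = sumℤ n (λ k → h (suc k) * a (suc k))
  B  = sumℤ n (λ k → h (suc k) * b k)
  drop-top : sumℤ (suc n) (λ k → h k * a k) ≡ sumℤ n (λ k → h k * a k)
  drop-top = trans (cong (λ v → sumℤ n (λ k → h k * a k) + h (suc n) * v) top)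
                   (trans (cong (_+_ (sumℤ n (λ k → h k * a k))) (ℤP.*-zeroʳ (h (suc n))))
                          (ℤP.+-identityʳ _))
  expand : ∀ k → h (suc k) * d (suc k) ≡ h (suc k) * a (suc k) + s * (h (suc k) * b k)
  expand k = trans (cong (h (suc k) *_) (step k)) (distrib (h (suc k)) _ s (b k))
    where
    distrib : ∀ p q r t → p * (q + r * t) ≡ p * q + r * (p * t)
    distrib = solve-∀

bit : Bool → ℕ
bit b = if b then 1 else 0

sign : Bool → ℤ
sign false = + 1
sign true  = -1ℤ

χ : ∀ {n} → Vec Bool n → Vec Bool n → ℤ
χ []      []      = + 1
χ (a ∷ u) (b ∷ z) = sign (a ∧ b) * χ u z

wt : ∀ {n} → Vec Bool n → ℕ
wt []      = 0
wt (a ∷ u) = bit a ℕ.+ wt u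

wt-≤ : ∀ {n} (u : Vec Bool n) → wt u ≤ n
wt-≤ []          = z≤n
wt-≤ (false ∷ u) = ℕP.m≤n⇒m≤1+n (wt-≤ u)
wt-≤ (true ∷ u)  = s≤s (wt-≤ u)

hamming-≤ : ∀ {n} (x y : Vec Bool n) → hamming x y ≤ n
hamming-≤ []      []      = z≤n
hamming-≤ (a ∷ x) (b ∷ y) with a xor b
... | false = ℕP.m≤n⇒m≤1+n (hamming-≤ x y)
... | true  = s≤s (hamming-≤ x y)

fourier : (n : ℕ) → (Vec Bool n → ℤ) → Vec Bool n → ℤ
fourier n f u = ΣV n (λ z → χ u z * f z)

ΣV-sign : ∀ n s (f g : Vec Bool n → ℤ) →
  ΣV n (λ z → s * f z * g z) ≡ s * ΣV n (λ z → f z * g z)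
ΣV-sign n s f g = trans (ΣL-cong (allVecs n) (λ z → ℤP.*-assoc s (f z) (g z))) (ΣL-* (allVecs n) s _)

fourier-cons : ∀ n (f : Vec Bool (suc n) → ℤ) a u →
  fourier (suc n) f (a ∷ u)
    ≡ fourier n (λ z → f (false ∷ z)) u + sign a * fourier n (λ z → f (true ∷ z)) u
fourier-cons n f a u = begin
    fourier (suc n) f (a ∷ u)
  ≡⟨ ΣV-suc n _ ⟩
    ΣV n (λ z → sign (a ∧ false) * χ u z * f (false ∷ z))
      + ΣV n (λ z → sign (a ∧ true) * χ u z * f (true ∷ z))
  ≡⟨ cong₂ _+_ (ΣV-sign n (sign (a ∧ false)) (χ u) (λ z → f (false ∷ z)))
                 (ΣV-sign n (sign (a ∧ true)) (χ u) (λ z → f (true ∷ z))) ⟩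
    sign (a ∧ false) * F₀ + sign (a ∧ true) * F₁
  ≡⟨ cong₂ (λ p q → sign p * F₀ + sign q * F₁) (∧-zeroʳ a) (∧-identityʳ a) ⟩
    + 1 * F₀ + sign a * F₁
  ≡⟨ cong (_+ sign a * F₁) (ℤP.*-identityˡ F₀) ⟩
    F₀ + sign a * F₁ ∎
  where
  F₀ F₁ : ℤ
  F₀ = fourier n (λ z → f (false ∷ z)) u
  F₁ = fourier n (λ z → f (true ∷ z)) u

parseval : ∀ n (f g : Vec Bool n → ℤ) →
  + (2 ^ n) * ΣV n (λ z → f z * g z) ≡ ΣV n (λ u → fourier n f u * fourier n g u)
parseval zero    f g = base (f []) (g [])
  where
  base : ∀ p q → + 1 * (p * q + + 0) ≡ (+ 1 * p + + 0) * (+ 1 * q + + 0) + + 0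
  base = solve-∀
parseval (suc n) f g = begin
    + (2 ^ suc n) * ΣV (suc n) (λ z → f z * g z)
  ≡⟨ cong₂ _*_ (ℤP.pos-* 2 (2 ^ n)) (ΣV-suc n _) ⟩
    + 2 * + (2 ^ n) * (ΣV n (λ z → f₀ z * g₀ z) + ΣV n (λ z → f₁ z * g₁ z))
  ≡⟨ distrib (+ (2 ^ n)) _ _ ⟩
    + 2 * (+ (2 ^ n) * ΣV n (λ z → f₀ z * g₀ z) + + (2 ^ n) * ΣV n (λ z → f₁ z * g₁ z))
  ≡⟨ cong₂ (λ p q → + 2 * (p + q)) (parseval n f₀ g₀) (parseval n f₁ g₁) ⟩
    + 2 * (ΣV n (λ u → F₀ u * G₀ u) + ΣV n (λ u → F₁ u * G₁ u))
  ≡⟨ cong (+ 2 *_) (sym (ΣL-+ (allVecs n) _ _)) ⟩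
    + 2 * ΣV n (λ u → F₀ u * G₀ u + F₁ u * G₁ u)
  ≡⟨ sym (ΣL-* (allVecs n) (+ 2) _) ⟩
    ΣV n (λ u → + 2 * (F₀ u * G₀ u + F₁ u * G₁ u))
  ≡⟨ ΣL-cong (allVecs n) (λ u → polarise (F₀ u) (F₁ u) (G₀ u) (G₁ u)) ⟩
    ΣV n (λ u → (F₀ u + + 1 * F₁ u) * (G₀ u + + 1 * G₁ u)
                  + (F₀ u + -1ℤ * F₁ u) * (G₀ u + -1ℤ * G₁ u))
  ≡⟨ ΣL-+ (allVecs n) _ _ ⟩
    ΣV n (λ u → (F₀ u + + 1 * F₁ u) * (G₀ u + + 1 * G₁ u))
      + ΣV n (λ u → (F₀ u + -1ℤ * F₁ u) * (G₀ u + -1ℤ * G₁ u))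
  ≡⟨ cong₂ _+_ (transform-of false) (transform-of true) ⟩
    ΣV n (λ u → fourier (suc n) f (false ∷ u) * fourier (suc n) g (false ∷ u))
      + ΣV n (λ u → fourier (suc n) f (true ∷ u) * fourier (suc n) g (true ∷ u))
  ≡⟨ sym (ΣV-suc n _) ⟩
    ΣV (suc n) (λ u → fourier (suc n) f u * fourier (suc n) g u) ∎
  where
  f₀ f₁ g₀ g₁ F₀ F₁ G₀ G₁ : Vec Bool n → ℤ
  f₀ z = f (false ∷ z)
  f₁ z = f (true ∷ z)
  g₀ z = g (false ∷ z)
  g₁ z = g (true ∷ z)
  F₀ = fourier n f₀
  F₁ = fourier n f₁
  G₀ = fourier n g₀
  G₁ = fourier n g₁
  transform-of : ∀ a →
    ΣV n (λ u → (F₀ u + sign a * F₁ u) * (G₀ u + sign a * G₁ u))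
      ≡ ΣV n (λ u → fourier (suc n) f (a ∷ u) * fourier (suc n) g (a ∷ u))
  transform-of a =
    ΣL-cong (allVecs n) (λ u → sym (cong₂ _*_ (fourier-cons n f a u) (fourier-cons n g a u)))
  distrib : ∀ p a b → + 2 * p * (a + b) ≡ + 2 * (p * a + p * b)
  distrib = solve-∀
  polarise : ∀ p q r s →
    + 2 * (p * r + q * s) ≡ (p + + 1 * q) * (r + + 1 * s) + (p + -1ℤ * q) * (r + -1ℤ * s)
  polarise = solve-∀

-- within r d = 1 if d < r, else 0: the ball of radius r - 1 (empty for r = 0).
indicator : Bool → ℤ
indicator b = if b then + 1 else + 0

within : ℕ → ℕ → ℤ
within r d = indicator (d <ᵇ r)

within-shift : ∀ e r d → within r (bit e ℕ.+ d) ≡ within (r ∸ bit e) d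
within-shift false r       d = refl
within-shift true  zero    d = refl
within-shift true  (suc r) d = refl

-- The ball spectrum ψ n r k: the transform of the ball {d < r} at weight k,
--   ψ n 0 k = 0,  ψ n (t+1) 0 = Σ_{i≤t} C(n,i),  ψ n (t+1) (k+1) = K_t^{(n-1)}(k),
-- so that ψ n (t+1) is the paper's c(t) up to the degenerate case t = n.
ψ : ℕ → ℕ → ℕ → ℤ
ψ n zero    k       = + 0
ψ n (suc t) zero    = + sumℕ t (λ i → n C i)
ψ n (suc t) (suc k) = K (n ∸ 1) t k

binomial-prefix-pascal : ∀ n t →
  sumℕ (suc t) (λ i → suc n C i) ≡ sumℕ (suc t) (λ i → n C i) ℕ.+ sumℕ t (λ i → n C i)
binomial-prefix-pascal n zero = begin
    1 ℕ.+ (suc n C 1)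
  ≡⟨ cong (1 ℕ.+_) (sym (nCk+nC[k+1]≡[n+1]C[k+1] n 0)) ⟩
    1 ℕ.+ (1 ℕ.+ (n C 1))
  ≡⟨ cong suc (ℕP.+-comm 1 (n C 1)) ⟩
    1 ℕ.+ (n C 1) ℕ.+ 1 ∎
binomial-prefix-pascal n (suc t) = begin
    sumℕ (suc t) (λ i → suc n C i) ℕ.+ (suc n C suc (suc t))
  ≡⟨ cong₂ ℕ._+_ (binomial-prefix-pascal n t) (sym (nCk+nC[k+1]≡[n+1]C[k+1] n (suc t))) ⟩
    (S ℕ.+ p ℕ.+ S) ℕ.+ (p ℕ.+ q)
  ≡⟨ regroup S p q ⟩
    S ℕ.+ p ℕ.+ q ℕ.+ (S ℕ.+ p) ∎
  where
  S = sumℕ t (λ i → n C i)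
  p = n C suc t
  q = n C suc (suc t)
  regroup : ∀ a b c → a ℕ.+ b ℕ.+ a ℕ.+ (b ℕ.+ c) ≡ a ℕ.+ b ℕ.+ c ℕ.+ (a ℕ.+ b)
  regroup = ℕ-solve

-- Recurrences of the ball spectrum in the dimension, for a new coordinate of u
-- equal to 0 (weight k kept) and equal to 1 (weight k+1).
ψ-extend₀ : ∀ n r k → k ≤ n → ψ (suc n) r k ≡ ψ n r k + ψ n (r ∸ 1) k
ψ-extend₀ n       zero          k       _         = refl
ψ-extend₀ n       (suc zero)    zero    _         = refl
ψ-extend₀ n       (suc (suc t)) zero    _         =
  trans (cong +_ (binomial-prefix-pascal n t))
        (ℤP.pos-+ (sumℕ (suc t) (λ i → n C i)) (sumℕ t (λ i → n C i)))
ψ-extend₀ zero    (suc _)       (suc _) ()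
ψ-extend₀ (suc n) (suc zero)    (suc k) _         = refl
ψ-extend₀ (suc n) (suc (suc t)) (suc k) (s≤s k≤n) = K-pascal-n n t k k≤n

ψ-extend₁ : ∀ n r k → k ≤ n → ψ (suc n) r (suc k) ≡ ψ n r k - ψ n (r ∸ 1) k
ψ-extend₁ n       zero          k       _ = refl
ψ-extend₁ n       (suc zero)    zero    _ = refl
ψ-extend₁ n       (suc (suc t)) zero    _ = begin
    K n (suc t) 0
  ≡⟨ Kg-zeroᵃ n (suc t) ⟩
    + (n C suc t)
  ≡⟨ cancel (+ S) (+ (n C suc t)) ⟩
    (+ S + + (n C suc t)) - + S
  ≡⟨ cong (_- + S) (sym (ℤP.pos-+ S (n C suc t))) ⟩
    + (S ℕ.+ n C suc t) - + S ∎
  where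
  S = sumℕ t (λ i → n C i)
  cancel : ∀ a b → b ≡ (a + b) - a
  cancel = solve-∀
ψ-extend₁ zero    (suc _)       (suc _) ()
ψ-extend₁ (suc n) (suc zero)    (suc k) _ = refl
ψ-extend₁ (suc n) (suc (suc t)) (suc k) _ = K-pascal-x n t k

-- The four cases of the butterfly step for a ball centred at (b ∷ x),
-- evaluated at (a ∷ u) with |u| = k.
ψ-cons : ∀ n r k a b → k ≤ n →
  ψ n (r ∸ bit (b xor false)) k + sign a * ψ n (r ∸ bit (b xor true)) k
    ≡ sign (a ∧ b) * ψ (suc n) r (bit a ℕ.+ k)
ψ-cons n r k false false k≤n = begin
    ψ n r k + + 1 * ψ n (r ∸ 1) k   ≡⟨ cong (_+_ (ψ n r k)) (ℤP.*-identityˡ _) ⟩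
    ψ n r k + ψ n (r ∸ 1) k         ≡⟨ sym (ψ-extend₀ n r k k≤n) ⟩
    ψ (suc n) r k                   ≡⟨ sym (ℤP.*-identityˡ _) ⟩
    + 1 * ψ (suc n) r k             ∎
ψ-cons n r k false true k≤n = begin
    ψ n (r ∸ 1) k + + 1 * ψ n r k   ≡⟨ cong (_+_ (ψ n (r ∸ 1) k)) (ℤP.*-identityˡ _) ⟩
    ψ n (r ∸ 1) k + ψ n r k         ≡⟨ ℤP.+-comm _ (ψ n r k) ⟩
    ψ n r k + ψ n (r ∸ 1) k         ≡⟨ sym (ψ-extend₀ n r k k≤n) ⟩
    ψ (suc n) r k                   ≡⟨ sym (ℤP.*-identityˡ _) ⟩
    + 1 * ψ (suc n) r k             ∎
ψ-cons n r k true false k≤n = begin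
    ψ n r k + -1ℤ * ψ n (r ∸ 1) k   ≡⟨ cong (_+_ (ψ n r k)) (ℤP.-1*i≡-i _) ⟩
    ψ n r k - ψ n (r ∸ 1) k         ≡⟨ sym (ψ-extend₁ n r k k≤n) ⟩
    ψ (suc n) r (suc k)             ≡⟨ sym (ℤP.*-identityˡ _) ⟩
    + 1 * ψ (suc n) r (suc k)       ∎
ψ-cons n r k true true k≤n = begin
    ψ n (r ∸ 1) k + -1ℤ * ψ n r k   ≡⟨ cong (_+_ (ψ n (r ∸ 1) k)) (ℤP.-1*i≡-i _) ⟩
    ψ n (r ∸ 1) k - ψ n r k         ≡⟨ negate (ψ n r k) (ψ n (r ∸ 1) k) ⟩
    - (ψ n r k - ψ n (r ∸ 1) k)     ≡⟨ cong -_ (sym (ψ-extend₁ n r k k≤n)) ⟩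
    - ψ (suc n) r (suc k)           ≡⟨ sym (ℤP.-1*i≡-i _) ⟩
    -1ℤ * ψ (suc n) r (suc k)       ∎
  where
  negate : ∀ p q → q - p ≡ - (p - q)
  negate = solve-∀

ball-transform : ∀ n r (x u : Vec Bool n) →
  fourier n (λ z → within r (hamming x z)) u ≡ χ u x * ψ n r (wt u)
ball-transform zero r [] [] = trans (ℤP.+-identityʳ _) (cong (+ 1 *_) (centre r))
  where
  row-zero : ∀ t → sumℕ t (λ i → 0 C i) ≡ 1
  row-zero zero    = refl
  row-zero (suc t) = cong (ℕ._+ 0) (row-zero t)
  centre : ∀ r → within r 0 ≡ ψ 0 r 0
  centre zero    = refl
  centre (suc t) = cong +_ (sym (row-zero t))
ball-transform (suc n) r (b ∷ x) (a ∷ u) = begin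
    fourier (suc n) (λ z → within r (hamming (b ∷ x) z)) (a ∷ u)
  ≡⟨ fourier-cons n _ a u ⟩
    fourier n (λ z → within r (bit (b xor false) ℕ.+ hamming x z)) u
      + sign a * fourier n (λ z → within r (bit (b xor true) ℕ.+ hamming x z)) u
  ≡⟨ cong₂ (λ p q → p + sign a * q) (shifted (b xor false)) (shifted (b xor true)) ⟩
    χ u x * ψ n (r ∸ bit (b xor false)) k + sign a * (χ u x * ψ n (r ∸ bit (b xor true)) k)
  ≡⟨ factor (χ u x) _ (sign a) _ ⟩
    χ u x * (ψ n (r ∸ bit (b xor false)) k + sign a * ψ n (r ∸ bit (b xor true)) k)
  ≡⟨ cong (χ u x *_) (ψ-cons n r k a b (wt-≤ u)) ⟩
    χ u x * (sign (a ∧ b) * ψ (suc n) r (wt (a ∷ u)))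
  ≡⟨ swap (χ u x) (sign (a ∧ b)) _ ⟩
    χ (a ∷ u) (b ∷ x) * ψ (suc n) r (wt (a ∷ u)) ∎
  where
  k = wt u
  shifted : ∀ e →
    fourier n (λ z → within r (bit e ℕ.+ hamming x z)) u ≡ χ u x * ψ n (r ∸ bit e) k
  shifted e = trans (ΣL-cong (allVecs n) (λ z → cong (χ u z *_) (within-shift e r (hamming x z))))
                    (ball-transform n (r ∸ bit e) x u)
  factor : ∀ p q s t → p * q + s * (p * t) ≡ p * (q + s * t)
  factor = solve-∀
  swap : ∀ p s q → p * (s * q) ≡ s * p * q
  swap = solve-∀

-- The Krawtchouk recurrences in the form needed when the first bits of x and y
-- are b and b′: the distance grows by one exactly when the bits differ.
K-step : ∀ n w k b b′ → w ≤ n →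
  K (suc n) (suc k) (bit (b xor b′) ℕ.+ w) ≡ K n (suc k) w + sign b * sign b′ * K n k w
K-step n w k false false w≤n =
  trans (K-pascal-n n k w w≤n) (cong (_+_ (K n (suc k) w)) (sym (ℤP.*-identityˡ _)))
K-step n w k true  true  w≤n =
  trans (K-pascal-n n k w w≤n) (cong (_+_ (K n (suc k) w)) (sym (ℤP.*-identityˡ _)))
K-step n w k false true  _   =
  trans (K-pascal-x n k w) (cong (_+_ (K n (suc k) w)) (sym (ℤP.-1*i≡-i _)))
K-step n w k true  false _   =
  trans (K-pascal-x n k w) (cong (_+_ (K n (suc k) w)) (sym (ℤP.-1*i≡-i _)))

character-split : ∀ n (h : ℕ → ℤ) b b′ (x y : Vec Bool n) →
  ΣV (suc n) (λ u → χ u (b ∷ x) * χ u (b′ ∷ y) * h (wt u))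
    ≡ ΣV n (λ u → χ u x * χ u y * h (wt u))
      + sign b * sign b′ * ΣV n (λ u → χ u x * χ u y * h (suc (wt u)))
character-split n h b b′ x y = trans (ΣV-suc n _) (cong₂ _+_
  (ΣL-cong (allVecs n) (λ u → unit (χ u x) (χ u y) (h (wt u))))
  (trans (ΣL-cong (allVecs n) (λ u → pull (sign b) (sign b′) (χ u x) (χ u y) (h (suc (wt u)))))
         (ΣL-* (allVecs n) (sign b * sign b′) _)))
  where
  unit : ∀ p q r → + 1 * p * (+ 1 * q) * r ≡ p * q * r
  unit = solve-∀
  pull : ∀ s s′ p q r → s * p * (s′ * q) * r ≡ s * s′ * (p * q * r)
  pull = solve-∀

radial-character-sum : ∀ n (h : ℕ → ℤ) (x y : Vec Bool n) →
  ΣV n (λ u → χ u x * χ u y * h (wt u)) ≡ sumℤ n (λ k → h k * K n k (hamming x y))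
radial-character-sum zero    h []      []       = base (h 0)
  where
  base : ∀ p → + 1 * + 1 * p + + 0 ≡ p * + 1
  base = solve-∀
radial-character-sum (suc n) h (b ∷ x) (b′ ∷ y) = begin
    ΣV (suc n) (λ u → χ u (b ∷ x) * χ u (b′ ∷ y) * h (wt u))
  ≡⟨ character-split n h b b′ x y ⟩
    ΣV n (λ u → χ u x * χ u y * h (wt u))
      + sign b * sign b′ * ΣV n (λ u → χ u x * χ u y * h (suc (wt u)))
  ≡⟨ cong₂ (λ p q → p + sign b * sign b′ * q)
       (radial-character-sum n h x y) (radial-character-sum n (λ k → h (suc k)) x y) ⟩
    sumℤ n (λ k → h k * K n k w) + sign b * sign b′ * sumℤ n (λ k → h (suc k) * K n k w)
  ≡⟨ sum-recombine n h (λ k → K n k w) (λ k → K n k w)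
       (λ k → K (suc n) k (bit (b xor b′) ℕ.+ w)) (sign b * sign b′)
       (K-vanish n (suc n) w (hamming-≤ x y) ℕP.≤-refl) refl
       (λ k → K-step n w k b b′ (hamming-≤ x y)) ⟩
    sumℤ (suc n) (λ k → h k * K (suc n) k (hamming (b ∷ x) (b′ ∷ y))) ∎
  where
  w = hamming x y

count-filter : ∀ {A : Set} (P : A → Bool) (l : List A) →
  + length (filter (λ z → Data.Bool._≟_ (P z) true) l) ≡ ΣL l (λ z → indicator (P z))
count-filter P []      = refl
count-filter P (a ∷ l) with P a
... | true  = cong (_+_ (+ 1)) (count-filter P l)
... | false = trans (count-filter P l) (sym (ℤP.+-identityˡ _))

indicator-∧ : ∀ p q → indicator (p ∧ q) ≡ indicator p * indicator q
indicator-∧ true  true  = refl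
indicator-∧ true  false = refl
indicator-∧ false q     = refl

≤ᵇ-as-<ᵇ : ∀ d t → (d ≤ᵇ t) ≡ (d <ᵇ suc t)
≤ᵇ-as-<ᵇ zero    t = refl
≤ᵇ-as-<ᵇ (suc d) t = refl

μ-as-sum : ∀ n t (x y : Vec Bool n) →
  + μ t x y ≡ ΣV n (λ z → within (suc t) (hamming x z) * within (suc t) (hamming y z))
μ-as-sum n t x y = trans (count-filter (inBoth t x y) (allVecs n)) (ΣL-cong (allVecs n) (λ z →
  trans (indicator-∧ (hamming x z ≤ᵇ t) (hamming y z ≤ᵇ t))
        (cong₂ (λ p q → indicator p * indicator q)
               (≤ᵇ-as-<ᵇ (hamming x z) t) (≤ᵇ-as-<ᵇ (hamming y z) t))))

-- The ball spectrum is the paper's c_k(t); its special value c_k(n) = 0 is the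
-- vanishing of K_n^{(n-1)}.
ψ-is-c : ∀ n t k → k ≤ n → ψ n (suc t) k ≡ c n t k
ψ-is-c n       t zero    _         = refl
ψ-is-c zero    t (suc k) ()
ψ-is-c (suc n) t (suc k) (s≤s k≤n) = top-case (t ℕ.≟ suc n)
  where
  top-case : (d : Dec (t ≡ suc n)) → K n t k ≡ (if does d then + 0 else K n t k)
  top-case (yes refl) = K-vanish n (suc n) k k≤n ℕP.≤-refl
  top-case (no _)     = refl

lemma4p1 : (n : ℕ) (x y : Vec Bool n) (w t : ℕ) → hamming x y ≡ w → t ≤ n →
    (+ (2 ^ n)) ℤ.* (+ μ t x y) ≡ sumℤ n (λ k → c n t k ℤ.* c n t k ℤ.* K n k w)
lemma4p1 n x y w t refl _ = begin
    + (2 ^ n) * + μ t x y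
  ≡⟨ cong (+ (2 ^ n) *_) (μ-as-sum n t x y) ⟩
    + (2 ^ n) * ΣV n (λ z → ball x z * ball y z)
  ≡⟨ parseval n (ball x) (ball y) ⟩
    ΣV n (λ u → fourier n (ball x) u * fourier n (ball y) u)
  ≡⟨ ΣL-cong (allVecs n) (λ u → trans
       (cong₂ _*_ (ball-transform n (suc t) x u) (ball-transform n (suc t) y u))
       (regroup (χ u x) (χ u y) (ψ n (suc t) (wt u)))) ⟩
    ΣV n (λ u → χ u x * χ u y * h (wt u))
  ≡⟨ radial-character-sum n h x y ⟩
    sumℤ n (λ k → h k * K n k (hamming x y))
  ≡⟨ sumℤ-cong n (λ k k≤n → cong (λ v → v * v * K n k (hamming x y)) (ψ-is-c n t k k≤n)) ⟩
    sumℤ n (λ k → c n t k * c n t k * K n k (hamming x y)) ∎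
  where
  ball : Vec Bool n → Vec Bool n → ℤ
  ball centre z = within (suc t) (hamming centre z)
  h : ℕ → ℤ
  h k = ψ n (suc t) k * ψ n (suc t) k
  regroup : ∀ a b p → a * p * (b * p) ≡ a * b * (p * p)
  regroup = solve-∀
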